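{- For the online single-item lot-sizing problem with holding and delay costs (as defined in the context), with arbitrary demand-specific monotone holding-delay cost functions, there is a deterministic online algorithm that is $3$-competitive.
   Context: Time steps are $1,\dots,T$. There is a single item with ordering cost $K\ge 0$. There is a finite set $D$ of demands; each demand $d$ has a desired service time $t_d\in[T]$, an arrival time $a_d\le t_d$, and a holding-delay cost function $H^d:[T]\to[0,\infty]$ with $H^d_{t_d}=0$, $H^d_s=\infty$ for $s<a_d$, $H^d_s$ non-increasing in $s$ for $s\le t_d$, and $H^d_s$ non-decreasing in $s$ for $s>t_d$. A solution places replenishment orders at some times, each costing $K$, and assigns every demand $d$ to one order time $s$, incurring cost $H^d_s$. The total cost is $K$ times the number of orders plus the incurred holding-delay costs. Online: a demand (with $t_d$ and $H^d$) is revealed at time $a_d$; at each time $s$ the algorithm irrevocably decides whether to order at $s$ and which already-arrived unserved demands to serve. An online algorithm is $c$-competitive if on every instance its cost is at most $c$ times the optimal offline cost.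
   Formalization: The ordering cost $K$ and the finite values of the holding-delay costs $H^d_s$ are non-negative rationals rather than non-negative reals. -}

module Defs where

open import Data.Nat as ℕ using (ℕ; zero; suc)
open import Data.Fin using (Fin; toℕ; zero; suc)
open import Data.Bool using (Bool; true; false; if_then_else_; _∧_)
open import Data.List using (List; length)
open import Data.Maybe using (Maybe; just; nothing)
open import Data.Product using (Σ; _×_; _,_; proj₁; proj₂)
open import Data.Integer using (+_)
open import Data.Rational as ℚ using (ℚ; 0ℚ)
open import Relation.Nullary using (yes; no)
open import Relation.Binary.PropositionalEquality using (_≡_)

data Cost : Set where
  fin : ℚ → Cost
  ∞   : Cost

NonNeg : Cost → Set
NonNeg (fin q) = 0ℚ ℚ.≤ q
NonNeg ∞       = Data.Unit.⊤
  where import Data.Unit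

infixl 6 _⊕_
_⊕_ : Cost → Cost → Cost
fin p ⊕ fin q = fin (p ℚ.+ q)
fin _ ⊕ ∞     = ∞
∞     ⊕ _     = ∞

-- multiplication of a cost by a rational scalar (used only with c ≥ 0)
_⊙_ : ℚ → Cost → Cost
c ⊙ fin q = fin (c ℚ.* q)
c ⊙ ∞     = ∞

infix 4 _≤C_
data _≤C_ : Cost → Cost → Set where
  fin≤fin : ∀ {p q} → p ℚ.≤ q → fin p ≤C fin q
  _≤∞     : ∀ x → x ≤C ∞

three : ℚ
three = + 3 ℚ./ 1

sumFin : (n : ℕ) → (Fin n → Cost) → Cost
sumFin zero    f = fin 0ℚ
sumFin (suc n) f = f zero ⊕ sumFin n (λ i → f (suc i))

first : (n : ℕ) → (Fin n → Bool) → Maybe (Fin n)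
first zero    f = nothing
first (suc n) f with f zero
... | true  = just zero
... | false with first n (λ i → f (suc i))
...   | just i  = just (suc i)
...   | nothing = nothing

-- Demands over the horizon of T time steps (times are Fin T = 0..T-1).
-- The arrival time a_d is recorded by the batch in which the demand
-- appears (see Instance).

record Demand (T : ℕ) : Set where
  field
    due      : Fin T
    H        : Fin T → Cost
    H-nonneg : ∀ s → NonNeg (H s)
    H-due    : H due ≡ fin 0ℚ
    H-before : ∀ s s' → toℕ s ℕ.≤ toℕ s' → toℕ s' ℕ.≤ toℕ due → H s' ≤C H s
    H-after  : ∀ s s' → toℕ due ℕ.< toℕ s → toℕ s ℕ.≤ toℕ s' → H s ≤C H s'

open Demand public

record Instance (T : ℕ) : Set where
  field
    K        : ℚ
    K-nonneg : 0ℚ ℚ.≤ K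
    batch    : Fin T → List (Demand T)
    arr≤due  : ∀ a (i : Fin (length (batch a))) →
               toℕ a ℕ.≤ toℕ (due (Data.List.lookup (batch a) i))
    H-early  : ∀ a (i : Fin (length (batch a))) s → toℕ s ℕ.< toℕ a →
               H (Data.List.lookup (batch a) i) s ≡ ∞

open Instance public

DemId : ∀ {T} → Instance T → Set
DemId {T} I = Σ (Fin T) (λ a → Fin (length (batch I a)))

demand : ∀ {T} (I : Instance T) → DemId I → Demand T
demand I (a , i) = Data.List.lookup (batch I a) i

sumDem : ∀ {T} (I : Instance T) → (DemId I → Cost) → Cost
sumDem {T} I f = sumFin T (λ a → sumFin (length (batch I a)) (λ i → f (a , i)))

orderCost : ∀ {T} → ℚ → (Fin T → Bool) → Cost
orderCost {T} K O = sumFin T (λ s → if O s then fin K else fin 0ℚ)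

record Solution {T} (I : Instance T) : Set where
  field
    orders : Fin T → Bool
    assign : DemId I → Fin T
    valid  : ∀ d → orders (assign d) ≡ true

solCost : ∀ {T} {I : Instance T} → Solution I → Cost
solCost {T} {I} S =
  orderCost (K I) (Solution.orders S)
  ⊕ sumDem I (λ d → H (demand I d) (Solution.assign S d))

-- At time s the algorithm sees T, K and exactly the batches of demands
-- that arrived at times u ≤ s (each with its t_d and H^d).  It decides
-- whether to order at s and which of the visible demands to serve
-- (only demands not served earlier are actually affected; serving
-- happens only if an order is placed at s).  Since it is deterministic,
-- its own past decisions are a function of this information.

View : (T : ℕ) → Fin T → Set
View T s = (u : Fin T) → toℕ u ℕ.≤ toℕ s → List (Demand T)

Decision : (T : ℕ) (s : Fin T) → View T s → Set
Decision T s v = Bool × ((u : Fin T) (p : toℕ u ℕ.≤ toℕ s) → Fin (length (v u p)) → Bool)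

OnlineAlg : Set
OnlineAlg = (T : ℕ) (K : ℚ) (s : Fin T) (v : View T s) → Decision T s v

module Run (alg : OnlineAlg) {T : ℕ} (I : Instance T) where

  decide : (s : Fin T) → Decision T s (λ u _ → batch I u)
  decide s = alg T (K I) s (λ u _ → batch I u)

  ordersAt : Fin T → Bool
  ordersAt s = proj₁ (decide s)

  servesAt : DemId I → Fin T → Bool
  servesAt (a , i) s with toℕ a ℕ.≤? toℕ s
  ... | yes p = ordersAt s ∧ proj₂ (decide s) a p i
  ... | no  _ = false

  -- the (irrevocable) time at which d is served: the first such time
  serviceTime : DemId I → Maybe (Fin T)
  serviceTime d = first T (servesAt d)

  demCost : DemId I → Cost
  demCost d with serviceTime d
  ... | just s  = H (demand I d) s
  ... | nothing = ∞            -- an unserved demand makes the run infeasible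

  algCost : Cost
  algCost = orderCost (K I) ordersAt ⊕ sumDem I demCost

-- c-competitiveness: on every instance, ALG ≤ c · cost(S) for every
-- offline solution S (equivalently ALG ≤ c · OPT, as OPT is a minimum
-- over the finitely many order sets).
Competitive : ℚ → OnlineAlg → Set
Competitive c alg =
  ∀ (T : ℕ) (I : Instance T) (S : Solution I) →
  Run.algCost alg I ≤C c ⊙ solCost S

-- The algorithm keeps the window [start u, u] of due times since its last order. The
-- pressure of a window is what the known demands due in it would cost if served at the
-- cheaper neighbour of the window: the last order just before it, or the time just after
-- it. The algorithm orders at u as soon as this pressure reaches K. At an order p it plans
-- its next order at the first v whose window [p + 1, v] reaches pressure K from the demands
-- known at p, and serves every known demand that is due by p, or due before the plan and
-- at least as expensive to serve at the plan.
--
-- A demand served late at an order n was not served at the previous order p, whence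
-- H n ≤ H p; so its cost is its share of the pressure of the window between p and n, which
-- stayed below K as no order was placed at n - 1. A demand served early at n costs at most
-- its share of the pressure of [n + 1, plan - 1], which is below K by the choice of the
-- plan. So each order pays K for itself and at most 2K for its demands. The windows of the
-- orders are disjoint, and each either contains an order of a given offline solution, or
-- that solution serves all demands due in it outside it, at cost at least its pressure,
-- hence at least K. So K times the number of orders bounds every offline cost from below.

module Submission where

open import Defs
open import Level using (0ℓ)
open import Function using (case_of_)
open import Data.Empty using (⊥; ⊥-elim)
open import Data.Bool as Bool using (Bool; true; false; if_then_else_; _∧_)
open import Data.Bool.Properties using (¬-not)
open import Data.Nat as ℕ using (ℕ; zero; suc; _∸_; z≤n; s≤s)
import Data.Nat.Properties as ℕ
open import Data.Fin as Fin using (Fin; toℕ)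
import Data.Fin.Properties as Fin
open import Data.List using (List; []; length; lookup)
open import Data.Maybe using (just; nothing)
open import Data.Product using (Σ; ∃; _×_; _,_; proj₁; proj₂; map₂)
open import Data.Sum using (_⊎_; inj₁; inj₂)
open import Data.Rational as ℚ using (ℚ; 0ℚ)
import Data.Rational.Properties as ℚ
open import Data.Rational.Solver using (module +-*-Solver)
open import Algebra.Bundles using (CommutativeMonoid)
open import Relation.Binary using (Total; Decidable; TotalOrder; tri<; tri≈; tri>)
import Relation.Binary.Reasoning.PartialOrder as PartialOrderReasoning
open import Relation.Binary.PropositionalEquality
open import Relation.Nullary using (Dec; yes; no; ¬_; does; _×-dec_; _⊎-dec_)
open import Relation.Nullary.Decidable using (dec-true; dec-false)

-- Costs

0C : Cost
0C = fin 0ℚ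

⊕-assoc : ∀ x y z → (x ⊕ y) ⊕ z ≡ x ⊕ (y ⊕ z)
⊕-assoc (fin p) (fin q) (fin r) = cong fin (ℚ.+-assoc p q r)
⊕-assoc (fin _) (fin _) ∞       = refl
⊕-assoc (fin _) ∞       _       = refl
⊕-assoc ∞       _       _       = refl

⊕-identityˡ : ∀ x → 0C ⊕ x ≡ x
⊕-identityˡ (fin q) = cong fin (ℚ.+-identityˡ q)
⊕-identityˡ ∞       = refl

⊕-identityʳ : ∀ x → x ⊕ 0C ≡ x
⊕-identityʳ (fin q) = cong fin (ℚ.+-identityʳ q)
⊕-identityʳ ∞       = refl

⊕-comm : ∀ x y → x ⊕ y ≡ y ⊕ x
⊕-comm (fin p) (fin q) = cong fin (ℚ.+-comm p q)
⊕-comm (fin _) ∞       = refl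
⊕-comm ∞       (fin _) = refl
⊕-comm ∞       ∞       = refl

⊕-0C-commutativeMonoid : CommutativeMonoid 0ℓ 0ℓ
⊕-0C-commutativeMonoid = record
  { Carrier = Cost
  ; _≈_ = _≡_
  ; _∙_ = _⊕_
  ; ε = 0C
  ; isCommutativeMonoid = record
    { isMonoid = record
      { isSemigroup = record
        { isMagma = record { isEquivalence = isEquivalence ; ∙-cong = cong₂ _⊕_ }
        ; assoc = ⊕-assoc
        }
      ; identity = ⊕-identityˡ , ⊕-identityʳ
      }
    ; comm = ⊕-comm
    }
  }

≤C-refl : ∀ {x} → x ≤C x
≤C-refl {fin q} = fin≤fin ℚ.≤-refl
≤C-refl {∞}     = ∞ ≤∞

≤C-trans : ∀ {x y z} → x ≤C y → y ≤C z → x ≤C z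
≤C-trans (fin≤fin p) (fin≤fin q) = fin≤fin (ℚ.≤-trans p q)
≤C-trans (fin≤fin _) (_ ≤∞)      = _ ≤∞
≤C-trans (_ ≤∞)      (∞ ≤∞)      = _ ≤∞

≤C-reflexive : ∀ {x y} → x ≡ y → x ≤C y
≤C-reflexive refl = ≤C-refl

≤C-antisym : ∀ {x y} → x ≤C y → y ≤C x → x ≡ y
≤C-antisym (fin≤fin p) (fin≤fin q) = cong fin (ℚ.≤-antisym p q)
≤C-antisym (∞ ≤∞)      _           = refl

≤C-total : Total _≤C_
≤C-total (fin p) (fin q) with ℚ.≤-total p q
... | inj₁ p≤q = inj₁ (fin≤fin p≤q)
... | inj₂ q≤p = inj₂ (fin≤fin q≤p)
≤C-total x       ∞       = inj₁ (x ≤∞)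
≤C-total ∞       y       = inj₂ (y ≤∞)

_≤C?_ : Decidable _≤C_
fin p ≤C? fin q with p ℚ.≤? q
... | yes p≤q = yes (fin≤fin p≤q)
... | no  p≰q = no λ { (fin≤fin p≤q) → p≰q p≤q }
fin p ≤C? ∞     = yes (_ ≤∞)
∞     ≤C? fin q = no λ ()
∞     ≤C? ∞     = yes (∞ ≤∞)

≤C-totalOrder : TotalOrder 0ℓ 0ℓ 0ℓ
≤C-totalOrder = record
  { Carrier = Cost
  ; _≈_ = _≡_
  ; _≤_ = _≤C_
  ; isTotalOrder = record
    { isPartialOrder = record
      { isPreorder = record
        { isEquivalence = isEquivalence
        ; reflexive = ≤C-reflexive
        ; trans = ≤C-trans
        }
      ; antisym = ≤C-antisym
      }
    ; total = ≤C-total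
    }
  }

open import Algebra.Construct.NaturalChoice.Min ≤C-totalOrder
  using (_⊓_; x⊓y≤x; x⊓y≤y; ⊓-glb; ⊓-identityʳ)
open import Algebra.Properties.CommutativeMonoid.Sum ⊕-0C-commutativeMonoid
  using (sum; ∑-comm; ∑-distrib-+; sum-cong-≗; sum-replicate-zero)
module ≤C-Reasoning = PartialOrderReasoning (TotalOrder.poset ≤C-totalOrder) hiding (start)

≰C⇒≥ : ∀ {x y} → ¬ x ≤C y → y ≤C x
≰C⇒≥ {x} {y} x≰y with ≤C-total x y
... | inj₁ x≤y = ⊥-elim (x≰y x≤y)
... | inj₂ y≤x = y≤x

0≤-nonNeg : ∀ {x} → NonNeg x → 0C ≤C x
0≤-nonNeg {fin q} 0≤q = fin≤fin 0≤q
0≤-nonNeg {∞}     _   = 0C ≤∞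

⊕-mono-≤C : ∀ {x y u v} → x ≤C y → u ≤C v → x ⊕ u ≤C y ⊕ v
⊕-mono-≤C (fin≤fin p) (fin≤fin q) = fin≤fin (ℚ.+-mono-≤ p q)
⊕-mono-≤C (fin≤fin _) (_ ≤∞)      = _ ≤∞
⊕-mono-≤C (_ ≤∞)      _           = _ ≤∞

x≤x⊕y : ∀ x {y} → 0C ≤C y → x ≤C x ⊕ y
x≤x⊕y x 0≤y = subst (_≤C x ⊕ _) (⊕-identityʳ x) (⊕-mono-≤C (≤C-refl {x}) 0≤y)

y≤x⊕y : ∀ {x} y → 0C ≤C x → y ≤C x ⊕ y
y≤x⊕y y 0≤x = subst (_≤C _ ⊕ y) (⊕-identityˡ y) (⊕-mono-≤C 0≤x (≤C-refl {y}))

0≤⊕ : ∀ {x y} → 0C ≤C x → 0C ≤C y → 0C ≤C x ⊕ y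
0≤⊕ 0≤x 0≤y = ⊕-mono-≤C 0≤x 0≤y

⊕-triple : ∀ x → x ⊕ (x ⊕ x) ≡ three ⊙ x
⊕-triple (fin q) = cong fin (solve 1 (λ q → q :+ (q :+ q) := con three :* q) refl q)
  where open +-*-Solver
⊕-triple ∞       = refl

when : Bool → Cost → Cost
when b x = if b then x else 0C

when-0≤ : ∀ b {x} → 0C ≤C x → 0C ≤C when b x
when-0≤ true  0≤x = 0≤x
when-0≤ false _   = ≤C-refl

when-≤ : ∀ b {x y} → (b ≡ true → x ≤C y) → 0C ≤C y → when b x ≤C y
when-≤ true  x≤y _   = x≤y refl
when-≤ false _   0≤y = 0≤y

when-mono : ∀ b {x y} → (b ≡ true → x ≤C y) → when b x ≤C when b y
when-mono true  x≤y = x≤y refl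
when-mono false _   = ≤C-refl

when-guard-mono : ∀ b {b′ x} → (b ≡ true → b′ ≡ true) → 0C ≤C x → when b x ≤C when b′ x
when-guard-mono true  b⇒b′ _ rewrite b⇒b′ refl = ≤C-refl
when-guard-mono false _    0≤x = when-0≤ _ 0≤x

when-0C : ∀ b → when b 0C ≡ 0C
when-0C true  = refl
when-0C false = refl

when-⊕ : ∀ b x y → when b (x ⊕ y) ≡ when b x ⊕ when b y
when-⊕ true  x y = refl
when-⊕ false x y = refl

∧-true⁻ : ∀ {b₁ b₂} → b₁ ∧ b₂ ≡ true → b₁ ≡ true × b₂ ≡ true
∧-true⁻ {true} {true} _ = refl , refl

does-true⇒ : ∀ {A : Set} (a? : Dec A) → does a? ≡ true → A
does-true⇒ (yes a) _ = a

does-false⇒ : ∀ {A : Set} (a? : Dec A) → does a? ≡ false → ¬ A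
does-false⇒ (no ¬a) _ = ¬a

-- Finite sums

sumFin-sum : ∀ n (f : Fin n → Cost) → sumFin n f ≡ sum f
sumFin-sum zero    f = refl
sumFin-sum (suc n) f = cong (f Fin.zero ⊕_) (sumFin-sum n (λ i → f (Fin.suc i)))

sumFin-cong : ∀ n {f g : Fin n → Cost} → (∀ i → f i ≡ g i) → sumFin n f ≡ sumFin n g
sumFin-cong n {f} {g} f≗g = begin
  sumFin n f ≡⟨ sumFin-sum n f ⟩
  sum f      ≡⟨ sum-cong-≗ f≗g ⟩
  sum g      ≡⟨ sumFin-sum n g ⟨
  sumFin n g ∎
  where open ≡-Reasoning

sumFin-zero : ∀ n {f : Fin n → Cost} → (∀ i → f i ≡ 0C) → sumFin n f ≡ 0C
sumFin-zero n {f} f≗0 = begin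
  sumFin n f         ≡⟨ sumFin-cong n f≗0 ⟩
  sumFin n (λ _ → 0C) ≡⟨ sumFin-sum n _ ⟩
  sum {n} (λ _ → 0C) ≡⟨ sum-replicate-zero n ⟩
  0C                 ∎
  where open ≡-Reasoning

sumFin-⊕ : ∀ n (f g : Fin n → Cost) → sumFin n (λ i → f i ⊕ g i) ≡ sumFin n f ⊕ sumFin n g
sumFin-⊕ n f g = begin
  sumFin n (λ i → f i ⊕ g i) ≡⟨ sumFin-sum n _ ⟩
  sum (λ i → f i ⊕ g i)      ≡⟨ ∑-distrib-+ f g ⟩
  sum f ⊕ sum g              ≡⟨ cong₂ _⊕_ (sumFin-sum n f) (sumFin-sum n g) ⟨
  sumFin n f ⊕ sumFin n g    ∎
  where open ≡-Reasoning

sumFin-comm : ∀ m n (f : Fin m → Fin n → Cost) →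
  sumFin m (λ i → sumFin n (f i)) ≡ sumFin n (λ j → sumFin m (λ i → f i j))
sumFin-comm m n f = begin
  sumFin m (λ i → sumFin n (f i))             ≡⟨ sumFin-sum m _ ⟩
  sum (λ i → sumFin n (f i))                  ≡⟨ sum-cong-≗ (λ i → sumFin-sum n (f i)) ⟩
  sum (λ i → sum (f i))                       ≡⟨ ∑-comm f ⟩
  sum (λ j → sum (λ i → f i j))               ≡⟨ sum-cong-≗ (λ j → sumFin-sum m (λ i → f i j)) ⟨
  sum (λ j → sumFin m (λ i → f i j))          ≡⟨ sumFin-sum n _ ⟨
  sumFin n (λ j → sumFin m (λ i → f i j))     ∎
  where open ≡-Reasoning

sumFin-mono : ∀ n {f g : Fin n → Cost} → (∀ i → f i ≤C g i) → sumFin n f ≤C sumFin n g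
sumFin-mono zero    _   = ≤C-refl
sumFin-mono (suc n) f≤g = ⊕-mono-≤C (f≤g Fin.zero) (sumFin-mono n (λ i → f≤g (Fin.suc i)))

sumFin-0≤ : ∀ n {f : Fin n → Cost} → (∀ i → 0C ≤C f i) → 0C ≤C sumFin n f
sumFin-0≤ n 0≤f =
  ≤C-trans (≤C-reflexive (sym (sumFin-zero n {λ _ → 0C} (λ _ → refl)))) (sumFin-mono n 0≤f)

term≤sumFin : ∀ n {f : Fin n → Cost} → (∀ i → 0C ≤C f i) → ∀ j → f j ≤C sumFin n f
term≤sumFin (suc n) 0≤f Fin.zero    = x≤x⊕y _ (sumFin-0≤ n (λ i → 0≤f (Fin.suc i)))
term≤sumFin (suc n) 0≤f (Fin.suc j) =
  ≤C-trans (term≤sumFin n (λ i → 0≤f (Fin.suc i)) j) (y≤x⊕y _ (0≤f Fin.zero))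

sumFin-when-unique : ∀ n (b : Fin n → Bool) {x} → 0C ≤C x →
  (∀ i j → b i ≡ true → b j ≡ true → i Fin.< j → ⊥) →
  sumFin n (λ i → when (b i) x) ≤C x
sumFin-when-unique zero    b 0≤x _      = 0≤x
sumFin-when-unique (suc n) b {x} 0≤x unique with b Fin.zero in b₀
... | false = subst (_≤C x) (sym (⊕-identityˡ _))
                (sumFin-when-unique n (λ i → b (Fin.suc i)) 0≤x
                   (λ i j bi bj i<j → unique (Fin.suc i) (Fin.suc j) bi bj (s≤s i<j)))
... | true  = ≤C-reflexive (trans (cong (x ⊕_) (sumFin-zero n others-vanish)) (⊕-identityʳ x))
  where
  others-vanish : ∀ i → when (b (Fin.suc i)) x ≡ 0C
  others-vanish i with b (Fin.suc i) in bᵢ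
  ... | true  = ⊥-elim (unique Fin.zero (Fin.suc i) b₀ bᵢ (s≤s z≤n))
  ... | false = refl

module _ {T} (I : Instance T) where

  sumDem-mono : ∀ {f g : DemId I → Cost} → (∀ dd → f dd ≤C g dd) → sumDem I f ≤C sumDem I g
  sumDem-mono f≤g = sumFin-mono T λ a → sumFin-mono (length (batch I a)) λ i → f≤g (a , i)

  sumDem-0≤ : ∀ {f : DemId I → Cost} → (∀ dd → 0C ≤C f dd) → 0C ≤C sumDem I f
  sumDem-0≤ 0≤f = sumFin-0≤ T λ a → sumFin-0≤ (length (batch I a)) λ i → 0≤f (a , i)

  sumDem-zero : ∀ {f : DemId I → Cost} → (∀ dd → f dd ≡ 0C) → sumDem I f ≡ 0C
  sumDem-zero f≗0 = sumFin-zero T λ a → sumFin-zero (length (batch I a)) λ i → f≗0 (a , i)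

  term≤sumDem : ∀ {f : DemId I → Cost} → (∀ dd → 0C ≤C f dd) → ∀ dd → f dd ≤C sumDem I f
  term≤sumDem 0≤f (a , i) = ≤C-trans
    (term≤sumFin (length (batch I a)) (λ j → 0≤f (a , j)) i)
    (term≤sumFin T (λ b → sumFin-0≤ (length (batch I b)) λ j → 0≤f (b , j)) a)

  sumDem-⊕ : ∀ (f g : DemId I → Cost) → sumDem I (λ dd → f dd ⊕ g dd) ≡ sumDem I f ⊕ sumDem I g
  sumDem-⊕ f g = trans
    (sumFin-cong T λ a → sumFin-⊕ (length (batch I a)) (λ i → f (a , i)) (λ i → g (a , i)))
    (sumFin-⊕ T _ _)

  sumDem-comm : ∀ (f : DemId I → Fin T → Cost) →
    sumDem I (λ dd → sumFin T (f dd)) ≡ sumFin T (λ s → sumDem I (λ dd → f dd s))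
  sumDem-comm f = trans
    (sumFin-cong T λ a → sumFin-comm (length (batch I a)) T λ i → f (a , i))
    (sumFin-comm T T λ a s → sumFin (length (batch I a)) λ i → f (a , i) s)

  sumDem-when : ∀ b (f : DemId I → Cost) → sumDem I (λ dd → when b (f dd)) ≡ when b (sumDem I f)
  sumDem-when true  f = refl
  sumDem-when false f = sumDem-zero λ _ → refl

-- Searching

first-sound : ∀ n (f : Fin n → Bool) {i} → first n f ≡ just i → f i ≡ true
first-sound (suc n) f first≡i with f Fin.zero in f₀
first-sound (suc n) f refl | true = f₀
... | false with first n (λ i → f (Fin.suc i)) in first′≡i
first-sound (suc n) f refl | false | just i = first-sound n (λ i → f (Fin.suc i)) first′≡i

first-least : ∀ n (f : Fin n → Bool) {i} → first n f ≡ just i → ∀ j → j Fin.< i → f j ≡ false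
first-least (suc n) f first≡i j j<i with f Fin.zero in f₀
first-least (suc n) f refl j () | true
... | false with first n (λ i → f (Fin.suc i)) in first′≡i
first-least (suc n) f refl Fin.zero    _   | false | just i = f₀
first-least (suc n) f refl (Fin.suc j) j<i | false | just i =
  first-least n (λ i → f (Fin.suc i)) first′≡i j (ℕ.≤-pred j<i)

first-complete : ∀ n (f : Fin n → Bool) j → f j ≡ true → ∃ λ i → first n f ≡ just i
first-complete (suc n) f j fj with f Fin.zero in f₀
... | true = Fin.zero , refl
... | false with first n (λ i → f (Fin.suc i)) in first′≡
...   | just i = Fin.suc i , refl
first-complete (suc n) f Fin.zero    fj | false | nothing with () ← trans (sym fj) f₀
first-complete (suc n) f (Fin.suc j) fj | false | nothing
  with i , first′≡i ← first-complete n (λ i → f (Fin.suc i)) j fj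
  with () ← trans (sym first′≡) first′≡i

search : (ℕ → Bool) → ℕ → ℕ → ℕ
search f m zero    = m
search f m (suc k) = if f m then m else search f (suc m) k

search-≥ : ∀ f m k → m ℕ.≤ search f m k
search-≥ f m zero = ℕ.≤-refl
search-≥ f m (suc k) with f m
... | true  = ℕ.≤-refl
... | false = ℕ.≤-trans (ℕ.n≤1+n m) (search-≥ f (suc m) k)

search-found : ∀ f m k → search f m k ℕ.< m ℕ.+ k → f (search f m k) ≡ true
search-found f m zero m<m+0 = ⊥-elim (ℕ.<-irrefl (sym (ℕ.+-identityʳ m)) m<m+0)
search-found f m (suc k) found<m+1+k with f m in fm
... | true  = fm
... | false = search-found f (suc m) k (subst (search f (suc m) k ℕ.<_) (ℕ.+-suc m k) found<m+1+k)

search-least : ∀ f m k {v} → m ℕ.≤ v → v ℕ.< search f m k → f v ≡ false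
search-least f m zero    m≤v v<m = ⊥-elim (ℕ.<-irrefl refl (ℕ.<-≤-trans v<m m≤v))
search-least f m (suc k) m≤v v<found with f m in fm
... | true  = ⊥-elim (ℕ.<-irrefl refl (ℕ.<-≤-trans v<found m≤v))
... | false with ℕ.m≤n⇒m<n∨m≡n m≤v
...   | inj₁ m<v  = search-least f (suc m) k m<v v<found
...   | inj₂ refl = fm

search-cong : ∀ {f g} m k → (∀ v → f v ≡ g v) → search f m k ≡ search g m k
search-cong m zero    f≗g = refl
search-cong m (suc k) f≗g = cong₂ (λ b r → if b then m else r) (f≗g m) (search-cong (suc m) k f≗g)

-- Costs of a demand at natural times

inWindow? : ∀ w u x → Dec (w ℕ.≤ x × x ℕ.≤ u)
inWindow? w u x = (w ℕ.≤? x) ×-dec (x ℕ.≤? u)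

beyond-window : ∀ {w u x} → ¬ (w ℕ.≤ x × x ℕ.≤ u) → x ℕ.< w ⊎ u ℕ.< x
beyond-window {w} {u} {x} outside with w ℕ.≤? x | x ℕ.≤? u
... | no  w≰x | _       = inj₁ (ℕ.≰⇒> w≰x)
... | yes _   | no  x≰u = inj₂ (ℕ.≰⇒> x≰u)
... | yes w≤x | yes x≤u = ⊥-elim (outside (w≤x , x≤u))

module _ {T : ℕ} where

  tₙ : Demand T → ℕ
  tₙ d = toℕ (due d)

  Hₙ : Demand T → ℕ → Cost
  Hₙ d n with n ℕ.<? T
  ... | yes n<T = H d (Fin.fromℕ< n<T)
  ... | no  _   = ∞

  H⁻ : Demand T → ℕ → Cost
  H⁻ d zero    = ∞
  H⁻ d (suc p) = Hₙ d p

  toℕ-onto : ∀ {n} → n ℕ.< T → ∃ λ (s : Fin T) → toℕ s ≡ n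
  toℕ-onto n<T = Fin.fromℕ< n<T , Fin.toℕ-fromℕ< n<T

  Hₙ-toℕ : ∀ d s → Hₙ d (toℕ s) ≡ H d s
  Hₙ-toℕ d s with toℕ s ℕ.<? T
  ... | yes s<T = cong (H d) (Fin.fromℕ<-toℕ s s<T)
  ... | no  s≮T = ⊥-elim (s≮T (Fin.toℕ<n s))

  Hₙ-≥T : ∀ d {n} → T ℕ.≤ n → Hₙ d n ≡ ∞
  Hₙ-≥T d {n} T≤n with n ℕ.<? T
  ... | yes n<T = ⊥-elim (ℕ.<⇒≱ n<T T≤n)
  ... | no  _   = refl

  Hₙ-0≤ : ∀ d n → 0C ≤C Hₙ d n
  Hₙ-0≤ d n with n ℕ.<? T
  ... | yes n<T = 0≤-nonNeg (H-nonneg d (Fin.fromℕ< n<T))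
  ... | no  _   = 0C ≤∞

  H⁻-0≤ : ∀ d w → 0C ≤C H⁻ d w
  H⁻-0≤ d zero    = 0C ≤∞
  H⁻-0≤ d (suc p) = Hₙ-0≤ d p

  Hₙ-due : ∀ d → Hₙ d (tₙ d) ≡ 0C
  Hₙ-due d = trans (Hₙ-toℕ d (due d)) (H-due d)

  Hₙ-antitone : ∀ d {n n′} → n ℕ.≤ n′ → n′ ℕ.≤ tₙ d → Hₙ d n′ ≤C Hₙ d n
  Hₙ-antitone d n≤n′ n′≤t
    with s′ , refl ← toℕ-onto (ℕ.≤-<-trans n′≤t (Fin.toℕ<n (due d)))
    with s  , refl ← toℕ-onto (ℕ.≤-<-trans n≤n′ (Fin.toℕ<n s′))
    rewrite Hₙ-toℕ d s | Hₙ-toℕ d s′ = H-before d s s′ n≤n′ n′≤t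

  Hₙ-monotone : ∀ d {n n′} → tₙ d ℕ.< n → n ℕ.≤ n′ → Hₙ d n ≤C Hₙ d n′
  Hₙ-monotone d {n} {n′} t<n n≤n′ with T ℕ.≤? n′
  ... | yes T≤n′ rewrite Hₙ-≥T d T≤n′ = _ ≤∞
  ... | no  T≰n′
    with s′ , refl ← toℕ-onto (ℕ.≰⇒> T≰n′)
    with s  , refl ← toℕ-onto (ℕ.≤-<-trans n≤n′ (Fin.toℕ<n s′))
    rewrite Hₙ-toℕ d s | Hₙ-toℕ d s′ = H-after d s s′ t<n n≤n′

  -- By the monotonicity of H^d, no time outside a window [w, u] containing t_d is cheaper
  -- for d than w - 1 or u + 1 (⊓-≤-Hₙ-beyond).
  outside : ℕ → ℕ → Demand T → Cost
  outside w u d = when (does (inWindow? w u (tₙ d))) (H⁻ d w ⊓ Hₙ d (suc u))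

  outside-0≤ : ∀ w u d → 0C ≤C outside w u d
  outside-0≤ w u d = when-0≤ _ (⊓-glb (H⁻-0≤ d w) (Hₙ-0≤ d (suc u)))

  outside-empty : ∀ {w u} d → u ℕ.< w → outside w u d ≡ 0C
  outside-empty {w} {u} d u<w
    rewrite dec-false (inWindow? w u (tₙ d))
                      (λ (w≤t , t≤u) → ℕ.<-irrefl refl (ℕ.<-≤-trans u<w (ℕ.≤-trans w≤t t≤u)))
    = refl

  outside-inWindow : ∀ {w u} d → w ℕ.≤ tₙ d → tₙ d ℕ.≤ u → outside w u d ≡ H⁻ d w ⊓ Hₙ d (suc u)
  outside-inWindow {w} {u} d w≤t t≤u rewrite dec-true (inWindow? w u (tₙ d)) (w≤t , t≤u) = refl

  ⊓-≤-Hₙ-beyond : ∀ {w u s} d → w ℕ.≤ tₙ d → tₙ d ℕ.≤ u → s ℕ.< w ⊎ u ℕ.< s →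
    H⁻ d w ⊓ Hₙ d (suc u) ≤C Hₙ d s
  ⊓-≤-Hₙ-beyond {suc p} {u} d p<t t≤u (inj₁ (s≤s s≤p)) =
    ≤C-trans (x⊓y≤x (Hₙ d p) (Hₙ d (suc u))) (Hₙ-antitone d s≤p (ℕ.<⇒≤ p<t))
  ⊓-≤-Hₙ-beyond {w} {u} d w≤t t≤u (inj₂ u<s) =
    ≤C-trans (x⊓y≤y (H⁻ d w) (Hₙ d (suc u))) (Hₙ-monotone d (s≤s t≤u) u<s)

  pressureTerm : ℕ → ℕ → ℕ → ℕ → Demand T → Cost
  pressureTerm c w u a d = when (does (a ℕ.≤? c)) (outside w u d)

  pressureTerm-0≤ : ∀ c w u a d → 0C ≤C pressureTerm c w u a d
  pressureTerm-0≤ c w u a d = when-0≤ (does (a ℕ.≤? c)) (outside-0≤ w u d)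

  pressureTerm-arrived : ∀ {c a} w u d → a ℕ.≤ c → pressureTerm c w u a d ≡ outside w u d
  pressureTerm-arrived {c} {a} w u d a≤c rewrite dec-true (a ℕ.≤? c) a≤c = refl

  pressureTerm-unarrived : ∀ {c a} w u d → ¬ a ℕ.≤ c → pressureTerm c w u a d ≡ 0C
  pressureTerm-unarrived {c} {a} w u d a≰c rewrite dec-false (a ℕ.≤? c) a≰c = refl

  pressureTerm-empty : ∀ c {w u} a d → u ℕ.< w → pressureTerm c w u a d ≡ 0C
  pressureTerm-empty c a d u<w = trans (cong (when _) (outside-empty d u<w)) (when-0C (does (a ℕ.≤? c)))

  pressureTerm-mono : ∀ {c c′} w u a d → c ℕ.≤ c′ → pressureTerm c w u a d ≤C pressureTerm c′ w u a d
  pressureTerm-mono {c} {c′} w u a d c≤c′ =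
    when-guard-mono (does (a ℕ.≤? c))
      (λ a≤ᵇc → dec-true (a ℕ.≤? c′) (ℕ.≤-trans (does-true⇒ (a ℕ.≤? c) a≤ᵇc) c≤c′))
      (outside-0≤ w u d)

-- The algorithm

ServeNow : ∀ {T} → ℕ → ℕ → Demand T → Set
ServeNow p q d = tₙ d ℕ.≤ p ⊎ (tₙ d ℕ.< q × Hₙ d p ≤C Hₙ d q)

serveNow? : ∀ {T} p q (d : Demand T) → Dec (ServeNow p q d)
serveNow? p q d = (tₙ d ℕ.≤? p) ⊎-dec ((tₙ d ℕ.<? q) ×-dec (Hₙ d p ≤C? Hₙ d q))

module Algorithm (T : ℕ) (K : ℚ) (B : Fin T → List (Demand T)) where

  pressure : ℕ → ℕ → ℕ → Cost
  pressure c w u =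
    sumFin T λ a → sumFin (length (B a)) λ i → pressureTerm c w u (toℕ a) (lookup (B a) i)

  start : ℕ → ℕ
  orderAt : ℕ → Bool
  start zero    = zero
  start (suc u) = if orderAt u then suc u else start u
  orderAt u = does (fin K ≤C? pressure u (start u) u)

  -- The next order time if no further demand arrived, or T if there is none.
  plan : ℕ → ℕ
  plan p = search (λ v → does (fin K ≤C? pressure p (suc p) v)) (suc p) (T ∸ suc p)

  serves : ℕ → Demand T → Bool
  serves p d = does (serveNow? p (plan p) d)

  module Properties where

    pressure-mono : ∀ {c c′} w u → c ℕ.≤ c′ → pressure c w u ≤C pressure c′ w u
    pressure-mono w u c≤c′ =
      sumFin-mono T λ a → sumFin-mono (length (B a)) λ i →
        pressureTerm-mono w u (toℕ a) (lookup (B a) i) c≤c′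

    pressure-empty : ∀ c {w u} → u ℕ.< w → pressure c w u ≡ 0C
    pressure-empty c {w} {u} u<w =
      sumFin-zero T λ a → sumFin-zero (length (B a)) λ i →
        pressureTerm-empty c (toℕ a) (lookup (B a) i) u<w

    start-ordered : ∀ {u} → orderAt u ≡ true → start (suc u) ≡ suc u
    start-ordered {u} ou = cong (λ b → if b then suc u else start u) ou

    start-unordered : ∀ {u} → orderAt u ≡ false → start (suc u) ≡ start u
    start-unordered {u} ou = cong (λ b → if b then suc u else start u) ou

    start≡suc⇒ordered : ∀ u {p} → start u ≡ suc p → orderAt p ≡ true × p ℕ.< u
    start≡suc⇒ordered (suc u) start≡ with orderAt u in ou
    start≡suc⇒ordered (suc u) refl | true = ou , ℕ.n<1+n u
    ... | false = map₂ ℕ.m<n⇒m<1+n (start≡suc⇒ordered u start≡)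

    ordered⇒<start : ∀ {p} u → orderAt p ≡ true → p ℕ.< u → p ℕ.< start u
    ordered⇒<start {p} (suc u) op p<1+u with orderAt u in ou
    ... | true  = p<1+u
    ... | false with ℕ.m≤n⇒m<n∨m≡n (ℕ.≤-pred p<1+u)
    ...   | inj₁ p<u  = ordered⇒<start u op p<u
    ...   | inj₂ refl with () ← trans (sym op) ou

    start-≤-quiet : ∀ {t} u → (∀ q → t ℕ.≤ q → q ℕ.< u → orderAt q ≡ false) → start u ℕ.≤ t
    start-≤-quiet {t} u quiet with start u in start≡
    ... | zero  = z≤n
    ... | suc p = ℕ.≰⇒> λ t≤p →
      let op , p<u = start≡suc⇒ordered u start≡ in case trans (sym op) (quiet p t≤p p<u) of λ ()

    NoOrderBetween : ℕ → ℕ → Set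
    NoOrderBetween p n = ∀ j → p ℕ.< j → j ℕ.< n → orderAt j ≡ false

    start≡suc⇒noOrderBetween : ∀ {u p} → start u ≡ suc p → NoOrderBetween p u
    start≡suc⇒noOrderBetween {u} start≡ j p<j j<u = ¬-not λ oj →
      ℕ.<-irrefl refl (ℕ.<-≤-trans p<j (ℕ.≤-pred (subst (j ℕ.<_) start≡ (ordered⇒<start u oj j<u))))

    noOrderBetween⇒start≡suc : ∀ {p} u → orderAt p ≡ true → p ℕ.< u → NoOrderBetween p u → start u ≡ suc p
    noOrderBetween⇒start≡suc {p} (suc u) op p<1+u quiet with ℕ.m≤n⇒m<n∨m≡n (ℕ.≤-pred p<1+u)
    ... | inj₂ refl = start-ordered op
    ... | inj₁ p<u  = trans (start-unordered (quiet u p<u (ℕ.n<1+n u)))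
                            (noOrderBetween⇒start≡suc u op p<u (λ j p<j j<u → quiet j p<j (ℕ.m<n⇒m<1+n j<u)))

    plan-> : ∀ p → p ℕ.< plan p
    plan-> p = search-≥ _ (suc p) (T ∸ suc p)

    plan-triggers : ∀ p → plan p ℕ.< T → fin K ≤C pressure p (suc p) (plan p)
    plan-triggers p plan<T = does-true⇒ (fin K ≤C? _)
      (search-found _ (suc p) (T ∸ suc p) (ℕ.<-≤-trans plan<T (ℕ.m≤n+m∸n T (suc p))))

    pressure-before-plan : ∀ p {v} → p ℕ.< v → v ℕ.< plan p → pressure p (suc p) v ≤C fin K
    pressure-before-plan p p<v v<plan =
      ≰C⇒≥ (does-false⇒ (fin K ≤C? _) (search-least _ (suc p) (T ∸ suc p) p<v v<plan))

    ordered-at-plan : ∀ {p} → orderAt p ≡ true → plan p ℕ.< T → NoOrderBetween p (plan p) →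
      orderAt (plan p) ≡ true
    ordered-at-plan {p} op plan<T quiet = dec-true (fin K ≤C? _) (begin
      fin K                                          ≤⟨ plan-triggers p plan<T ⟩
      pressure p (suc p) (plan p)                    ≤⟨ pressure-mono (suc p) (plan p) (ℕ.<⇒≤ (plan-> p)) ⟩
      pressure (plan p) (suc p) (plan p)             ≡⟨ cong (λ w → pressure (plan p) w (plan p)) start≡ ⟨
      pressure (plan p) (start (plan p)) (plan p)    ∎)
      where
      open ≤C-Reasoning
      start≡ = noOrderBetween⇒start≡suc (plan p) op (plan-> p) quiet

    noOrderBetween⇒≤plan : ∀ {p n} → orderAt p ≡ true → n ℕ.≤ T → NoOrderBetween p n → n ℕ.≤ plan p
    noOrderBetween⇒≤plan {p} op n≤T quiet = ℕ.≮⇒≥ λ plan<n →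
      let quiet′ j p<j j<plan = quiet j p<j (ℕ.<-trans j<plan plan<n)
          ordered = ordered-at-plan op (ℕ.<-≤-trans plan<n n≤T) quiet′
      in case trans (sym ordered) (quiet (plan p) (plan-> p) plan<n) of λ ()

visible : ∀ {T} (s : Fin T) → View T s → Fin T → List (Demand T)
visible s v a with toℕ a ℕ.≤? toℕ s
... | yes a≤s = v a a≤s
... | no  _   = []

alg : OnlineAlg
alg T K s v = orderAt (toℕ s) , λ u u≤s i → serves (toℕ s) (lookup (v u u≤s) i)
  where open Algorithm T K (visible s v)

module Locality {T : ℕ} {K : ℚ} {B₁ B₂ : Fin T → List (Demand T)} {n : ℕ}
                (agree : ∀ a → toℕ a ℕ.≤ n → B₁ a ≡ B₂ a) where

  private
    module A₁ = Algorithm T K B₁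
    module A₂ = Algorithm T K B₂

  pressure-local : ∀ {c} w u → c ℕ.≤ n → A₁.pressure c w u ≡ A₂.pressure c w u
  pressure-local {c} w u c≤n = sumFin-cong T batch-local
    where
    batchPressure : ℕ → List (Demand T) → Cost
    batchPressure a L = sumFin (length L) λ i → pressureTerm c w u a (lookup L i)

    unarrived : ∀ {a} → ¬ a ℕ.≤ c → ∀ L → batchPressure a L ≡ 0C
    unarrived a≰c L = sumFin-zero (length L) (λ i → pressureTerm-unarrived w u (lookup L i) a≰c)

    batch-local : ∀ a → batchPressure (toℕ a) (B₁ a) ≡ batchPressure (toℕ a) (B₂ a)
    batch-local a with toℕ a ℕ.≤? c
    ... | yes a≤c = cong (batchPressure (toℕ a)) (agree a (ℕ.≤-trans a≤c c≤n))
    ... | no  a≰c = trans (unarrived a≰c (B₁ a)) (sym (unarrived a≰c (B₂ a)))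

  start-local : ∀ u → u ℕ.≤ n → A₁.start u ≡ A₂.start u
  orderAt-local : ∀ u → u ℕ.≤ n → A₁.orderAt u ≡ A₂.orderAt u
  start-local zero    _   = refl
  start-local (suc u) u<n =
    cong₂ (λ b w → if b then suc u else w) (orderAt-local u (ℕ.<⇒≤ u<n)) (start-local u (ℕ.<⇒≤ u<n))
  orderAt-local u u≤n = cong (λ x → does (fin K ≤C? x)) (begin
    A₁.pressure u (A₁.start u) u ≡⟨ cong (λ w → A₁.pressure u w u) (start-local u u≤n) ⟩
    A₁.pressure u (A₂.start u) u ≡⟨ pressure-local (A₂.start u) u u≤n ⟩
    A₂.pressure u (A₂.start u) u ∎)
    where open ≡-Reasoning

  plan-local : ∀ p → p ℕ.≤ n → A₁.plan p ≡ A₂.plan p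
  plan-local p p≤n = search-cong (suc p) (T ∸ suc p)
    (λ v → cong (λ x → does (fin K ≤C? x)) (pressure-local (suc p) v p≤n))

  serves-local : ∀ p d → p ℕ.≤ n → A₁.serves p d ≡ A₂.serves p d
  serves-local p d p≤n = cong (λ q → does (serveNow? p q d)) (plan-local p p≤n)

-- Analysis on a fixed instance

module Analysis {T} (I : Instance T) where
  open Algorithm T (K I) (batch I)
  open Properties
  private module R = Run alg I

  arrival : DemId I → ℕ
  arrival (a , _) = toℕ a

  arrival≤due : ∀ dd → arrival dd ℕ.≤ tₙ (demand I dd)
  arrival≤due (a , i) = arr≤due I a i

  Hₙ-unarrived : ∀ dd {n} → n ℕ.< arrival dd → Hₙ (demand I dd) n ≡ ∞
  Hₙ-unarrived (a , i) n<a with s , refl ← toℕ-onto (ℕ.<-trans n<a (Fin.toℕ<n a)) =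
    trans (Hₙ-toℕ _ s) (H-early I a i s n<a)

  outside-≤-pressure : ∀ dd {c} w u → arrival dd ℕ.≤ c → outside w u (demand I dd) ≤C pressure c w u
  outside-≤-pressure dd {c} w u a≤c =
    subst (_≤C pressure c w u) (pressureTerm-arrived w u (demand I dd) a≤c)
      (term≤sumDem I (λ dd′ → pressureTerm-0≤ c w u (arrival dd′) (demand I dd′)) dd)

  K-0≤ : 0C ≤C fin (K I)
  K-0≤ = fin≤fin (K-nonneg I)

  visible-batch : ∀ s a → toℕ a ℕ.≤ toℕ s → visible s (λ u _ → batch I u) a ≡ batch I a
  visible-batch s a a≤s with toℕ a ℕ.≤? toℕ s
  ... | yes _   = refl
  ... | no a≰s = ⊥-elim (a≰s a≤s)

  module ViewAt (s : Fin T) = Locality {T} {K I} (visible-batch s)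

  ordersAt≡orderAt : ∀ s → R.ordersAt s ≡ orderAt (toℕ s)
  ordersAt≡orderAt s = ViewAt.orderAt-local s (toℕ s) ℕ.≤-refl

  servesAt-arrived : ∀ dd s → arrival dd ℕ.≤ toℕ s →
    R.servesAt dd s ≡ orderAt (toℕ s) ∧ serves (toℕ s) (demand I dd)
  servesAt-arrived (a , i) s a≤s with toℕ a ℕ.≤? toℕ s
  ... | yes _   = cong₂ _∧_ (ordersAt≡orderAt s) (ViewAt.serves-local s (toℕ s) _ ℕ.≤-refl)
  ... | no a≰s = ⊥-elim (a≰s a≤s)

  servesAt⇒arrived : ∀ dd s → R.servesAt dd s ≡ true → arrival dd ℕ.≤ toℕ s
  servesAt⇒arrived (a , i) s serves with toℕ a ℕ.≤? toℕ s
  ... | yes a≤s = a≤s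
  ... | no  _   with () ← serves

  record ServedAt (dd : DemId I) (n : ℕ) : Set where
    field
      in-horizon : n ℕ.< T
      arrived    : arrival dd ℕ.≤ n
      ordered    : orderAt n ≡ true
      serving    : ServeNow n (plan n) (demand I dd)

  servesAt⇒servedAt : ∀ dd s → R.servesAt dd s ≡ true → ServedAt dd (toℕ s)
  servesAt⇒servedAt dd s serves =
    let a≤s = servesAt⇒arrived dd s serves
        ordered , serving = ∧-true⁻ (trans (sym (servesAt-arrived dd s a≤s)) serves)
    in record { in-horizon = Fin.toℕ<n s ; arrived = a≤s ; ordered = ordered
              ; serving = does-true⇒ (serveNow? _ _ _) serving }

  servedAt⇒servesAt : ∀ dd s → ServedAt dd (toℕ s) → R.servesAt dd s ≡ true
  servedAt⇒servesAt dd s sa = trans (servesAt-arrived dd s arrived)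
    (cong₂ _∧_ ordered (dec-true (serveNow? _ _ _) serving))
    where open ServedAt sa

  FirstServedAt : DemId I → ℕ → Set
  FirstServedAt dd n = ServedAt dd n × (∀ m → m ℕ.< n → ¬ ServedAt dd m)

  serviceTime⇒firstServedAt : ∀ dd {s} → R.serviceTime dd ≡ just s → FirstServedAt dd (toℕ s)
  serviceTime⇒firstServedAt dd {s} first≡s =
    servesAt⇒servedAt dd s (first-sound T (R.servesAt dd) first≡s) , earlier
    where
    earlier : ∀ m → m ℕ.< toℕ s → ¬ ServedAt dd m
    earlier m m<s sa with s′ , refl ← toℕ-onto (ServedAt.in-horizon sa) =
      case trans (sym (servedAt⇒servesAt dd s′ sa)) (first-least T (R.servesAt dd) first≡s s′ m<s)
      of λ ()

  servedAt-due : ∀ dd {q} → q ℕ.< T → tₙ (demand I dd) ℕ.≤ q → orderAt q ≡ true → ServedAt dd q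
  servedAt-due dd q<T t≤q oq = record
    { in-horizon = q<T ; arrived = ℕ.≤-trans (arrival≤due dd) t≤q ; ordered = oq ; serving = inj₁ t≤q }

  -- The pressure at the last step bounds H^d at the last order p before t_d, so d has
  -- arrived by p; with no order after p the plan at p is T, so d is served at p.
  servedAt-unordered-from-due : ∀ dd {x} → suc x ≡ T → tₙ (demand I dd) ℕ.≤ x →
    (∀ q → tₙ (demand I dd) ℕ.≤ q → q ℕ.< T → orderAt q ≡ false) → ∃ (ServedAt dd)
  servedAt-unordered-from-due dd {x} 1+x≡T t≤x quiet = from-previous-order refl H⁻≤K
    where
    d = demand I dd
    x<T = subst (x ℕ.<_) 1+x≡T (ℕ.n<1+n x)
    unordered-x = quiet x t≤x x<T

    H⁻≤K : H⁻ d (start x) ≤C fin (K I)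
    H⁻≤K = begin
      H⁻ d (start x)                ≡⟨ ⊓-identityʳ _≤∞ (H⁻ d (start x)) ⟨
      H⁻ d (start x) ⊓ ∞            ≡⟨ cong (H⁻ d (start x) ⊓_) (Hₙ-≥T d (ℕ.≤-reflexive (sym 1+x≡T))) ⟨
      H⁻ d (start x) ⊓ Hₙ d (suc x) ≡⟨ outside-inWindow d start≤t t≤x ⟨
      outside (start x) x d         ≤⟨ outside-≤-pressure dd (start x) x (ℕ.≤-trans (arrival≤due dd) t≤x) ⟩
      pressure x (start x) x        ≤⟨ ≰C⇒≥ (does-false⇒ (fin (K I) ≤C? _) unordered-x) ⟩
      fin (K I)                     ∎
      where
      open ≤C-Reasoning
      start≤t = start-≤-quiet x λ q t≤q q<x → quiet q t≤q (ℕ.<-trans q<x x<T)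

    from-previous-order : ∀ {w} → start x ≡ w → H⁻ d w ≤C fin (K I) → ∃ (ServedAt dd)
    from-previous-order {zero}  _      ()
    from-previous-order {suc p} start≡ Hp≤K = p , record
      { in-horizon = ℕ.<-trans p<x x<T
      ; arrived    = ℕ.≮⇒≥ λ p<a → case subst (_≤C fin (K I)) (Hₙ-unarrived dd p<a) Hp≤K of λ ()
      ; ordered    = op
      ; serving    = inj₂ ( ℕ.<-≤-trans (Fin.toℕ<n (due d)) T≤plan
                          , subst (Hₙ d p ≤C_) (sym (Hₙ-≥T d T≤plan)) (Hₙ d p ≤∞) )
      }
      where
      op = proj₁ (start≡suc⇒ordered x start≡)
      p<x = proj₂ (start≡suc⇒ordered x start≡)
      start-T : start T ≡ suc p
      start-T = trans (cong start (sym 1+x≡T)) (trans (start-unordered unordered-x) start≡)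
      T≤plan = noOrderBetween⇒≤plan op ℕ.≤-refl (start≡suc⇒noOrderBetween start-T)

  servedAt-exists : ∀ dd → ∃ (ServedAt dd)
  servedAt-exists dd
    with Fin.any? (λ q → (tₙ (demand I dd) ℕ.≤? toℕ q) ×-dec (orderAt (toℕ q) Bool.≟ true))
  ... | yes (q , t≤q , oq) = toℕ q , servedAt-due dd (Fin.toℕ<n q) t≤q oq
  ... | no none = servedAt-unordered-from-due dd
                    (ℕ.suc-pred T {{ℕ.>-nonZero (ℕ.≤-<-trans z≤n t<T)}}) (ℕ.<⇒≤pred t<T) quiet
    where
    t<T = Fin.toℕ<n (due (demand I dd))
    quiet : ∀ q → tₙ (demand I dd) ℕ.≤ q → q ℕ.< T → orderAt q ≡ false
    quiet q t≤q q<T with s , refl ← toℕ-onto q<T = ¬-not λ oq → none (s , t≤q , oq)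

  serviceTime-just : ∀ dd → ∃ λ s → R.serviceTime dd ≡ just s
  serviceTime-just dd with n , sa ← servedAt-exists dd with s , refl ← toℕ-onto (ServedAt.in-horizon sa) =
    first-complete T (R.servesAt dd) s (servedAt⇒servesAt dd s sa)

  delayCharge : ℕ → DemId I → Cost
  delayCharge zero    _  = 0C
  delayCharge (suc m) dd = pressureTerm m (start (suc m)) m (arrival dd) (demand I dd)

  holdCharge : ℕ → DemId I → Cost
  holdCharge n dd = pressureTerm n (suc n) (ℕ.pred (plan n)) (arrival dd) (demand I dd)

  charge : ℕ → DemId I → Cost
  charge n dd = delayCharge n dd ⊕ holdCharge n dd

  delayCharge-0≤ : ∀ n dd → 0C ≤C delayCharge n dd
  delayCharge-0≤ zero    _  = ≤C-refl
  delayCharge-0≤ (suc m) dd = pressureTerm-0≤ m (start (suc m)) m (arrival dd) (demand I dd)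

  holdCharge-0≤ : ∀ n dd → 0C ≤C holdCharge n dd
  holdCharge-0≤ n dd = pressureTerm-0≤ n (suc n) (ℕ.pred (plan n)) (arrival dd) (demand I dd)

  charge-0≤ : ∀ n dd → 0C ≤C charge n dd
  charge-0≤ n dd = 0≤⊕ (delayCharge-0≤ n dd) (holdCharge-0≤ n dd)

  delayCharges-≤K : ∀ n → sumDem I (delayCharge n) ≤C fin (K I)
  delayCharges-≤K zero = ≤C-trans (≤C-reflexive (sumDem-zero I λ _ → refl)) K-0≤
  delayCharges-≤K (suc m) with orderAt m in om
  ... | true  = ≤C-trans (≤C-reflexive (pressure-empty m (ℕ.n<1+n m))) K-0≤
  ... | false = ≰C⇒≥ (does-false⇒ (fin (K I) ≤C? _) om)

  holdCharges-≤K : ∀ n → sumDem I (holdCharge n) ≤C fin (K I)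
  holdCharges-≤K n with suc n ℕ.≤? ℕ.pred (plan n)
  ... | yes n<pred = pressure-before-plan n n<pred
                       (ℕ.m≤pred[n]⇒suc[m]≤n {{ℕ.>-nonZero (ℕ.≤-<-trans z≤n (plan-> n))}} ℕ.≤-refl)
  ... | no  n≮pred = ≤C-trans (≤C-reflexive (pressure-empty n (ℕ.≰⇒> n≮pred))) K-0≤

  charges-≤2K : ∀ n → sumDem I (charge n) ≤C fin (K I) ⊕ fin (K I)
  charges-≤2K n = ≤C-trans (≤C-reflexive (sumDem-⊕ I (delayCharge n) (holdCharge n)))
                           (⊕-mono-≤C (delayCharges-≤K n) (holdCharges-≤K n))

  start-≤-due : ∀ dd {n} → FirstServedAt dd n → start n ℕ.≤ tₙ (demand I dd)
  start-≤-due dd {n} (sa , earlier) = start-≤-quiet n λ q t≤q q<n →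
    ¬-not λ oq → earlier q q<n (servedAt-due dd (ℕ.<-trans q<n (ServedAt.in-horizon sa)) t≤q oq)

  Hₙ-≤-H⁻-start : ∀ dd {n} → FirstServedAt dd n → tₙ (demand I dd) ℕ.< n →
    Hₙ (demand I dd) n ≤C H⁻ (demand I dd) (start n)
  Hₙ-≤-H⁻-start dd {n} (sa , earlier) t<n with start n in start≡
  ... | zero = _ ≤∞
  ... | suc p with arrival dd ℕ.≤? p
  ...   | no  a≰p rewrite Hₙ-unarrived dd (ℕ.≰⇒> a≰p) = _ ≤∞
  ...   | yes a≤p = begin
    Hₙ d n        ≤⟨ Hₙ-monotone d t<n n≤plan ⟩
    Hₙ d (plan p) ≤⟨ ≰C⇒≥ (λ p≤plan → earlier p p<n (servedAt-p p≤plan)) ⟩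
    Hₙ d p        ∎
    where
    open ≤C-Reasoning
    d = demand I dd
    op = proj₁ (start≡suc⇒ordered n start≡)
    p<n = proj₂ (start≡suc⇒ordered n start≡)
    n<T = ServedAt.in-horizon sa
    n≤plan = noOrderBetween⇒≤plan op (ℕ.<⇒≤ n<T) (start≡suc⇒noOrderBetween start≡)

    servedAt-p : Hₙ d p ≤C Hₙ d (plan p) → ServedAt dd p
    servedAt-p p≤plan = record
      { in-horizon = ℕ.<-trans p<n n<T ; arrived = a≤p ; ordered = op
      ; serving = inj₂ (ℕ.<-≤-trans t<n n≤plan , p≤plan) }

  Hₙ-≤-delayCharge : ∀ dd {n} → FirstServedAt dd n → tₙ (demand I dd) ℕ.< n →
    Hₙ (demand I dd) n ≤C delayCharge n dd
  Hₙ-≤-delayCharge dd {suc m} fsa t<n = begin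
    Hₙ d (suc m)                        ≤⟨ ⊓-glb (Hₙ-≤-H⁻-start dd fsa t<n) ≤C-refl ⟩
    H⁻ d (start (suc m)) ⊓ Hₙ d (suc m) ≡⟨ outside-inWindow d (start-≤-due dd fsa) t≤m ⟨
    outside (start (suc m)) m d         ≡⟨ pressureTerm-arrived (start (suc m)) m d a≤m ⟨
    delayCharge (suc m) dd              ∎
    where
    open ≤C-Reasoning
    d = demand I dd
    t≤m = ℕ.≤-pred t<n
    a≤m = ℕ.≤-trans (arrival≤due dd) t≤m

  Hₙ-≤-holdCharge : ∀ dd {n} → ServedAt dd n → n ℕ.< tₙ (demand I dd) → Hₙ (demand I dd) n ≤C holdCharge n dd
  Hₙ-≤-holdCharge dd {n} sa n<t with ServedAt.serving sa
  ... | inj₁ t≤n = ⊥-elim (ℕ.<⇒≱ n<t t≤n)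
  ... | inj₂ (t<plan , n≤plan) = begin
    Hₙ d n                                      ≤⟨ ⊓-glb ≤C-refl n≤plan ⟩
    Hₙ d n ⊓ Hₙ d (plan n)                      ≡⟨ cong (λ r → Hₙ d n ⊓ Hₙ d r) suc-pred-plan ⟨
    H⁻ d (suc n) ⊓ Hₙ d (suc (ℕ.pred (plan n))) ≡⟨ outside-inWindow d n<t (ℕ.<⇒≤pred t<plan) ⟨
    outside (suc n) (ℕ.pred (plan n)) d         ≡⟨ pressureTerm-arrived (suc n) _ d (ServedAt.arrived sa) ⟨
    holdCharge n dd                             ∎
    where
    open ≤C-Reasoning
    d = demand I dd
    suc-pred-plan = ℕ.suc-pred (plan n) {{ℕ.>-nonZero (ℕ.≤-<-trans z≤n (plan-> n))}}

  Hₙ-≤-charge : ∀ dd {n} → FirstServedAt dd n → Hₙ (demand I dd) n ≤C charge n dd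
  Hₙ-≤-charge dd {n} fsa with ℕ.<-cmp (tₙ (demand I dd)) n
  ... | tri< t<n _ _  = ≤C-trans (Hₙ-≤-delayCharge dd fsa t<n) (x≤x⊕y _ (holdCharge-0≤ n dd))
  ... | tri≈ _ refl _ = subst (_≤C charge n dd) (sym (Hₙ-due (demand I dd))) (charge-0≤ n dd)
  ... | tri> _ _ n<t  = ≤C-trans (Hₙ-≤-holdCharge dd (proj₁ fsa) n<t) (y≤x⊕y _ (delayCharge-0≤ n dd))

  ordersCost : Cost
  ordersCost = sumFin T λ s → when (orderAt (toℕ s)) (fin (K I))

  orderCost≡ordersCost : orderCost (K I) R.ordersAt ≡ ordersCost
  orderCost≡ordersCost = sumFin-cong T λ s → cong (λ b → when b (fin (K I))) (ordersAt≡orderAt s)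

  demCost-≤-charges : ∀ dd → R.demCost dd ≤C sumFin T λ s → when (orderAt (toℕ s)) (charge (toℕ s) dd)
  demCost-≤-charges dd with R.serviceTime dd in first≡
  ... | nothing with () ← trans (sym first≡) (proj₂ (serviceTime-just dd))
  ... | just s = begin
    H d s                                      ≡⟨ Hₙ-toℕ d s ⟨
    Hₙ d (toℕ s)                               ≤⟨ Hₙ-≤-charge dd fsa ⟩
    charge (toℕ s) dd                          ≡⟨ cong (λ b → when b (charge (toℕ s) dd)) ordered ⟨
    when (orderAt (toℕ s)) (charge (toℕ s) dd) ≤⟨ term≤sumFin T (λ s′ → when-0≤ _ (charge-0≤ (toℕ s′) dd)) s ⟩
    sumFin T (λ s′ → when (orderAt (toℕ s′)) (charge (toℕ s′) dd)) ∎
    where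
    open ≤C-Reasoning
    d = demand I dd
    fsa = serviceTime⇒firstServedAt dd first≡
    ordered = ServedAt.ordered (proj₁ fsa)

  demCosts-≤ : sumDem I R.demCost ≤C ordersCost ⊕ ordersCost
  demCosts-≤ = begin
    sumDem I R.demCost
      ≤⟨ sumDem-mono I demCost-≤-charges ⟩
    sumDem I (λ dd → sumFin T λ s → when (o s) (charge (toℕ s) dd))
      ≡⟨ sumDem-comm I _ ⟩
    sumFin T (λ s → sumDem I λ dd → when (o s) (charge (toℕ s) dd))
      ≡⟨ sumFin-cong T (λ s → sumDem-when I (o s) _) ⟩
    sumFin T (λ s → when (o s) (sumDem I (charge (toℕ s))))
      ≤⟨ sumFin-mono T (λ s → when-mono (o s) λ _ → charges-≤2K (toℕ s)) ⟩
    sumFin T (λ s → when (o s) (fin (K I) ⊕ fin (K I)))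
      ≡⟨ sumFin-cong T (λ s → when-⊕ (o s) _ _) ⟩
    sumFin T (λ s → when (o s) (fin (K I)) ⊕ when (o s) (fin (K I)))
      ≡⟨ sumFin-⊕ T _ _ ⟩
    ordersCost ⊕ ordersCost
      ∎
    where
    open ≤C-Reasoning
    o : Fin T → Bool
    o s = orderAt (toℕ s)

  covers : ℕ → ℕ → Bool
  covers s x = orderAt s ∧ does (inWindow? (start s) s x)

  covers-unique : ∀ x (i j : Fin T) → covers (toℕ i) x ≡ true → covers (toℕ j) x ≡ true → i Fin.< j → ⊥
  covers-unique x i j ci cj i<j =
    let oi , in-i = ∧-true⁻ {orderAt (toℕ i)} ci
        _  , in-j = ∧-true⁻ {orderAt (toℕ j)} cj
        _  , x≤i  = does-true⇒ (inWindow? (start (toℕ i)) (toℕ i) x) in-i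
        sj≤x , _  = does-true⇒ (inWindow? (start (toℕ j)) (toℕ j) x) in-j
    in ℕ.<-irrefl refl (ℕ.<-≤-trans (ordered⇒<start (toℕ j) oi i<j) (ℕ.≤-trans sj≤x x≤i))

  module _ (Sol : Solution I) where
    open Solution Sol renaming (orders to optOrders)

    optOrderCost : Fin T → Cost
    optOrderCost u = when (optOrders u) (fin (K I))

    optDemandCost : DemId I → Cost
    optDemandCost dd = H (demand I dd) (assign dd)

    optOrderCost-0≤ : ∀ u → 0C ≤C optOrderCost u
    optOrderCost-0≤ u = when-0≤ (optOrders u) K-0≤

    optDemandCost-0≤ : ∀ dd → 0C ≤C optDemandCost dd
    optDemandCost-0≤ dd = 0≤-nonNeg (H-nonneg (demand I dd) (assign dd))

    coveredOrderCost : ℕ → Fin T → Cost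
    coveredOrderCost s u = when (covers s (toℕ u)) (optOrderCost u)

    coveredDemandCost : ℕ → DemId I → Cost
    coveredDemandCost s dd = when (covers s (tₙ (demand I dd))) (optDemandCost dd)

    coveredOrderCost-0≤ : ∀ s u → 0C ≤C coveredOrderCost s u
    coveredOrderCost-0≤ s u = when-0≤ (covers s (toℕ u)) (optOrderCost-0≤ u)

    coveredDemandCost-0≤ : ∀ s dd → 0C ≤C coveredDemandCost s dd
    coveredDemandCost-0≤ s dd = when-0≤ (covers s (tₙ (demand I dd))) (optDemandCost-0≤ dd)

    windowCost : ℕ → Cost
    windowCost s = sumFin T (coveredOrderCost s) ⊕ sumDem I (coveredDemandCost s)

    windowCost-0≤ : ∀ s → 0C ≤C windowCost s
    windowCost-0≤ s = 0≤⊕ (sumFin-0≤ T (coveredOrderCost-0≤ s)) (sumDem-0≤ I (coveredDemandCost-0≤ s))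

    order-≤-windowCost : ∀ {s} → orderAt s ≡ true → fin (K I) ≤C windowCost s
    order-≤-windowCost {s} os
      with Fin.any? (λ u → (covers s (toℕ u) Bool.≟ true) ×-dec (optOrders u Bool.≟ true))
    ... | yes (u , cu , ou) = begin
      fin (K I)                      ≡⟨ cong₂ (λ b c → when b (when c (fin (K I)))) cu ou ⟨
      coveredOrderCost s u           ≤⟨ term≤sumFin T (coveredOrderCost-0≤ s) u ⟩
      sumFin T (coveredOrderCost s)  ≤⟨ x≤x⊕y _ (sumDem-0≤ I (coveredDemandCost-0≤ s)) ⟩
      windowCost s                   ∎
      where open ≤C-Reasoning
    ... | no none = begin
      fin (K I)                      ≤⟨ does-true⇒ (fin (K I) ≤C? _) os ⟩
      pressure s (start s) s         ≤⟨ sumDem-mono I pressureTerm-≤-opt ⟩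
      sumDem I (coveredDemandCost s) ≤⟨ y≤x⊕y _ (sumFin-0≤ T (coveredOrderCost-0≤ s)) ⟩
      windowCost s                   ∎
      where
      open ≤C-Reasoning

      assign-beyond : ∀ dd → toℕ (assign dd) ℕ.< start s ⊎ s ℕ.< toℕ (assign dd)
      assign-beyond dd = beyond-window λ inside →
        let inWindow? = inWindow? (start s) s (toℕ (assign dd))
        in none (assign dd , trans (cong (_∧ does inWindow?) os) (dec-true inWindow? inside) , valid dd)

      pressureTerm-≤-opt : ∀ dd →
        pressureTerm s (start s) s (arrival dd) (demand I dd) ≤C coveredDemandCost s dd
      pressureTerm-≤-opt dd = begin
        pressureTerm s (start s) s (arrival dd) d
          ≤⟨ when-≤ (does (arrival dd ℕ.≤? s)) (λ _ → ≤C-refl) (outside-0≤ (start s) s d) ⟩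
        outside (start s) s d
          ≤⟨ when-mono inWindow beyond ⟩
        when inWindow (Hₙ d (toℕ (assign dd)))
          ≡⟨ cong₂ (λ b x → when (b ∧ inWindow) x) os (sym (Hₙ-toℕ d (assign dd))) ⟨
        coveredDemandCost s dd
          ∎
        where
        d = demand I dd
        inWindow = does (inWindow? (start s) s (tₙ d))

        beyond : inWindow ≡ true → H⁻ d (start s) ⊓ Hₙ d (suc s) ≤C Hₙ d (toℕ (assign dd))
        beyond inside = let w≤t , t≤s = does-true⇒ (inWindow? _ _ _) inside
                        in ⊓-≤-Hₙ-beyond d w≤t t≤s (assign-beyond dd)

    ordersCost-≤-solCost : ordersCost ≤C solCost Sol
    ordersCost-≤-solCost = begin
      ordersCost
        ≤⟨ sumFin-mono T (λ s → when-≤ _ order-≤-windowCost (windowCost-0≤ (toℕ s))) ⟩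
      sumFin T (λ s → windowCost (toℕ s))
        ≡⟨ sumFin-⊕ T _ _ ⟩
      sumFin T (λ s → sumFin T (coveredOrderCost (toℕ s)))
        ⊕ sumFin T (λ s → sumDem I (coveredDemandCost (toℕ s)))
        ≡⟨ cong₂ _⊕_ (sumFin-comm T T _) (sumDem-comm I _) ⟨
      sumFin T (λ u → sumFin T λ s → coveredOrderCost (toℕ s) u)
        ⊕ sumDem I (λ dd → sumFin T λ s → coveredDemandCost (toℕ s) dd)
        ≤⟨ ⊕-mono-≤C (sumFin-mono T each-order) (sumDem-mono I each-demand) ⟩
      sumFin T optOrderCost ⊕ sumDem I optDemandCost
        ∎
      where
      open ≤C-Reasoning

      each-order : ∀ u → sumFin T (λ s → coveredOrderCost (toℕ s) u) ≤C optOrderCost u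
      each-order u = sumFin-when-unique T _ (optOrderCost-0≤ u) (covers-unique (toℕ u))

      each-demand : ∀ dd → sumFin T (λ s → coveredDemandCost (toℕ s) dd) ≤C optDemandCost dd
      each-demand dd = sumFin-when-unique T _ (optDemandCost-0≤ dd) (covers-unique (tₙ (demand I dd)))

    competitive : R.algCost ≤C three ⊙ solCost Sol
    competitive = begin
      orderCost (K I) R.ordersAt ⊕ sumDem I R.demCost ≡⟨ cong (_⊕ sumDem I R.demCost) orderCost≡ordersCost ⟩
      ordersCost ⊕ sumDem I R.demCost                 ≤⟨ ⊕-mono-≤C (≤C-refl {ordersCost}) demCosts-≤ ⟩
      ordersCost ⊕ (ordersCost ⊕ ordersCost)          ≤⟨ ⊕-mono-≤C opt (⊕-mono-≤C opt opt) ⟩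
      solCost Sol ⊕ (solCost Sol ⊕ solCost Sol)       ≡⟨ ⊕-triple (solCost Sol) ⟩
      three ⊙ solCost Sol                             ∎
      where
      open ≤C-Reasoning
      opt = ordersCost-≤-solCost

mainTheorem3 : Σ OnlineAlg (λ alg → Competitive three alg)
mainTheorem3 = alg , λ T I Sol → Analysis.competitive I Sol
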